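{- Let $f:\mathbb{N}\to\mathbb{R}^+$ be a concave and increasing sequence, let $a\in\mathbb{N}$, and let $G$ be an $s$-vertex graph whose vertex set is partitioned into $r$ parts, each of size at most $a$, such that either every two vertices in distinct parts are adjacent, or every two vertices in distinct parts are non-adjacent (edges inside the parts are arbitrary). Suppose that every set of $s'\le s$ vertices of $G$ induces a subgraph containing an induced cograph on at least $f(s')$ vertices. Then $G$ contains an induced cograph on at least $\lfloor s/a\rfloor\cdot f(a)$ vertices.
   Context: $\mathbb{N}$ denotes the non-negative integers. A sequence $f:\mathbb{N}\to\mathbb{R}^+$ is concave if $f(i)-f(i-1)\ge f(i+1)-f(i)$ for all integers $i\ge 1$. A cograph is defined recursively: a single-vertex graph is a cograph, and a graph obtained as a vertex-disjoint union of two smaller cographs whose vertex sets form a pure pair (i.e. either all edges between them are present or none are) is a cograph. -}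

module Defs where

open import Level using (Level; _⊔_) renaming (suc to lsuc)
open import Data.Nat as ℕ using (ℕ; zero; suc)
open import Data.Nat.DivMod using (_/_)
open import Data.Fin using (Fin)
open import Data.Fin.Subset using (Subset; _∈_; _∪_; _∩_; ⁅_⁆; Empty; ∣_∣)
open import Data.Vec using (tabulate)
open import Data.Bool using (Bool)
open import Data.Product using (_×_)
open import Data.Sum using (_⊎_)
open import Relation.Nullary using (¬_)
open import Relation.Nullary.Decidable using (⌊_⌋)
open import Relation.Binary using (Rel; IsTotalOrder)
open import Relation.Binary.PropositionalEquality using (_≡_)
open import Algebra.Bundles using (CommutativeRing)

-- Ordered commutative rings (the reals ℝ are an instance).  The
-- standard library has no real numbers, so the sequence f takes values
-- in an arbitrary totally ordered commutative ring.

record OrderedCommRing (c ℓ₁ ℓ₂ : Level) : Set (lsuc (c ⊔ ℓ₁ ⊔ ℓ₂)) where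
  field
    commutativeRing : CommutativeRing c ℓ₁
  open CommutativeRing commutativeRing public
  field
    _≤_          : Rel Carrier ℓ₂
    isTotalOrder : IsTotalOrder _≈_ _≤_
    +-monoˡ-≤    : ∀ {x y} z → x ≤ y → (x + z) ≤ (y + z)
    *-nonneg     : ∀ {x y} → 0# ≤ x → 0# ≤ y → 0# ≤ (x * y)
    nontrivial   : ¬ (1# ≈ 0#)

  _<_ : Rel Carrier (ℓ₁ ⊔ ℓ₂)
  x < y = (x ≤ y) × ¬ (x ≈ y)

  fromℕ : ℕ → Carrier
  fromℕ zero    = 0#
  fromℕ (suc n) = 1# + fromℕ n

module _ {c ℓ₁ ℓ₂} (R : OrderedCommRing c ℓ₁ ℓ₂) where
  open OrderedCommRing R

  -- f(i) - f(i-1) ≥ f(i+1) - f(i) for all i ≥ 1, written additively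
  Concave : (ℕ → Carrier) → Set ℓ₂
  Concave f = ∀ i → (f (suc (suc i)) + f i) ≤ (f (suc i) + f (suc i))

  Increasing : (ℕ → Carrier) → Set ℓ₂
  Increasing f = ∀ i → f i ≤ f (suc i)

  Positive : (ℕ → Carrier) → Set (ℓ₁ ⊔ ℓ₂)
  Positive f = ∀ i → 0# < f i

record Graph (n : ℕ) : Set₁ where
  field
    Adj     : Fin n → Fin n → Set
    sym     : ∀ {u v} → Adj u v → Adj v u
    irrefl  : ∀ {u} → ¬ Adj u u

module _ {n : ℕ} (G : Graph n) where
  open Graph G

  Complete : Subset n → Subset n → Set
  Complete A B = ∀ u v → u ∈ A → v ∈ B → Adj u v

  Anticomplete : Subset n → Subset n → Set
  Anticomplete A B = ∀ u v → u ∈ A → v ∈ B → ¬ Adj u v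

  data IsCograph : Subset n → Set where
    single : ∀ v → IsCograph ⁅ v ⁆
    union  : ∀ {A B} → IsCograph A → IsCograph B → Empty (A ∩ B) →
             Complete A B ⊎ Anticomplete A B → IsCograph (A ∪ B)

-- ⌊ s / a ⌋, with the (irrelevant) convention ⌊ s / 0 ⌋ = 0
floorDiv : ℕ → ℕ → ℕ
floorDiv s zero    = 0
floorDiv s (suc a) = s / suc a

partSet : ∀ {s r} → (Fin s → Fin r) → Fin r → Subset s
partSet part j = tabulate (λ v → ⌊ part v Data.Fin.≟ j ⌋)

-- Choose in every part P_j a cograph C_j with f(|P_j|) ≤ |C_j| (nothing for an empty part, so
-- f(0) is replaced by 0). Distinct parts form pure pairs, so the union of the C_j is again a
-- cograph, and it remains to show ⌊s/a⌋·f(a) ≤ Σ_j f(|P_j|) when Σ_j |P_j| = s and |P_j| ≤ a.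
-- Concavity gives f(u) + f(v) ≤ f(x) + f(y) whenever u ≤ x, y and u + v = x + y. Adding the parts
-- one at a time and writing the running total as q·a + ρ with ρ ≤ a, the invariant
-- q·f(a) + f(ρ) ≤ (running sum of f) survives each step: when the remainders overflow a, the
-- exchange with v = a trades f(ρ) + f(p) for f(a) + f(ρ + p − a).
module Submission where

open import Defs
open import Level using (Level)
open import Data.Nat as ℕ using (ℕ; zero; suc; z≤n; s≤s) renaming (_≤_ to _≤ℕ_)
import Data.Nat.Properties as ℕₚ
open import Data.Nat.DivMod using (_/_; m*n/n≡m; m<n⇒m/n≡0; +-distrib-/-∣ˡ)
open import Data.Nat.Divisibility using (divides)
open import Data.Nat.Solver using (module +-*-Solver)
open import Data.Fin using (Fin; _≟_) renaming (zero to fzero; suc to fsuc)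
open import Data.Fin.Subset using (Subset; _⊆_; ∣_∣; Empty; _∈_; _∪_; _∩_; ⊥; ⋃; inside; outside)
open import Data.Fin.Subset.Properties
  using (x∈p∪q⁻; x∈p∩q⁻; ∉⊥; ∣⊥∣≡0; drop-∷-Empty; Empty-unique; ∪-identityˡ; ∪-identityʳ)
import Data.Fin.Properties as Finₚ
open import Data.List using (tabulate)
open import Data.Vec using (_∷_; []; here; there)
open import Data.Product using (Σ; _×_; _,_; proj₁; ∃-syntax)
open import Data.Sum as Sum using (_⊎_; inj₁; inj₂)
open import Data.Empty using (⊥-elim)
open import Function using (_∘_)
open import Relation.Nullary using (¬_; yes; no)
open import Relation.Nullary.Decidable using (⌊_⌋; isYes≗does)
open import Relation.Binary using (IsTotalOrder; Poset)
open import Relation.Binary.PropositionalEquality as ≡ using (_≡_; _≢_)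
import Relation.Binary.Reasoning.PartialOrder as PosetReasoning
import Algebra.Properties.CommutativeMonoid.Sum as CommutativeMonoidSum
import Algebra.Solver.CommutativeMonoid as CommutativeMonoidSolver
import Algebra.Properties.Ring as RingProperties
open import Algebra.Properties.CommutativeSemigroup ℕₚ.+-commutativeSemigroup using (x∙yz≈y∙xz)

module ℕ∑ = CommutativeMonoidSum ℕₚ.+-0-commutativeMonoid

floorDiv-*+ : ∀ k {m a} → m ≤ℕ a →
              floorDiv (k ℕ.* a ℕ.+ m) a ≤ℕ k ⊎ (m ≡ a × floorDiv (k ℕ.* a ℕ.+ m) a ≡ suc k)
floorDiv-*+ k {a = zero}  _   = inj₁ z≤n
floorDiv-*+ k {m} {suc a} m≤a with ℕₚ.m≤n⇒m<n∨m≡n m≤a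
... | inj₁ m<a = inj₁ (ℕₚ.≤-reflexive (begin
  (k ℕ.* suc a ℕ.+ m) / suc a           ≡⟨ +-distrib-/-∣ˡ m (divides k ≡.refl) ⟩
  k ℕ.* suc a / suc a ℕ.+ m / suc a     ≡⟨ ≡.cong₂ ℕ._+_ (m*n/n≡m k (suc a)) (m<n⇒m/n≡0 m<a) ⟩
  k ℕ.+ 0                               ≡⟨ ℕₚ.+-identityʳ k ⟩
  k                                     ∎))
  where open ≡.≡-Reasoning
... | inj₂ ≡.refl =
  inj₂ (≡.refl , ≡.trans (≡.cong (_/ suc a) (ℕₚ.+-comm (k ℕ.* suc a) (suc a))) (m*n/n≡m (suc k) (suc a)))

quotient-remainder-merge : ∀ k₁ k₂ a {k₃ m₁ m₂ m₃} → k₃ ℕ.* a ℕ.+ m₃ ≡ m₁ ℕ.+ m₂ →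
                           (k₁ ℕ.+ k₂ ℕ.+ k₃) ℕ.* a ℕ.+ m₃ ≡ (k₁ ℕ.* a ℕ.+ m₁) ℕ.+ (k₂ ℕ.* a ℕ.+ m₂)
quotient-remainder-merge k₁ k₂ a {k₃} {m₁} {m₂} {m₃} k₃a+m₃≡m₁+m₂ = begin
  (k₁ ℕ.+ k₂ ℕ.+ k₃) ℕ.* a ℕ.+ m₃
    ≡⟨ solve 5 (λ k₁ k₂ k₃ a m₃ → (k₁ :+ k₂ :+ k₃) :* a :+ m₃ := k₁ :* a :+ k₂ :* a :+ (k₃ :* a :+ m₃))
               ≡.refl k₁ k₂ k₃ a m₃ ⟩
  k₁ ℕ.* a ℕ.+ k₂ ℕ.* a ℕ.+ (k₃ ℕ.* a ℕ.+ m₃)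
    ≡⟨ ≡.cong (k₁ ℕ.* a ℕ.+ k₂ ℕ.* a ℕ.+_) k₃a+m₃≡m₁+m₂ ⟩
  k₁ ℕ.* a ℕ.+ k₂ ℕ.* a ℕ.+ (m₁ ℕ.+ m₂)
    ≡⟨ solve 5 (λ k₁ k₂ a m₁ m₂ → k₁ :* a :+ k₂ :* a :+ (m₁ :+ m₂) := (k₁ :* a :+ m₁) :+ (k₂ :* a :+ m₂))
               ≡.refl k₁ k₂ a m₁ m₂ ⟩
  (k₁ ℕ.* a ℕ.+ m₁) ℕ.+ (k₂ ℕ.* a ℕ.+ m₂)
    ∎
  where open ≡.≡-Reasoning; open +-*-Solver

u+v≡x+y⇒v≡x∸u+y : ∀ {u x y v} → u ≤ℕ x → u ℕ.+ v ≡ x ℕ.+ y → v ≡ (x ℕ.∸ u) ℕ.+ y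
u+v≡x+y⇒v≡x∸u+y {u} {x} {y} {v} u≤x u+v≡x+y = ℕₚ.+-cancelˡ-≡ u v ((x ℕ.∸ u) ℕ.+ y) (begin
  u ℕ.+ v                      ≡⟨ u+v≡x+y ⟩
  x ℕ.+ y                      ≡⟨ ≡.cong (ℕ._+ y) (ℕₚ.m∸n+n≡m u≤x) ⟨
  (x ℕ.∸ u ℕ.+ u) ℕ.+ y        ≡⟨ ≡.cong (ℕ._+ y) (ℕₚ.+-comm (x ℕ.∸ u) u) ⟩
  (u ℕ.+ (x ℕ.∸ u)) ℕ.+ y      ≡⟨ ℕₚ.+-assoc u (x ℕ.∸ u) y ⟩
  u ℕ.+ ((x ℕ.∸ u) ℕ.+ y)      ∎)
  where open ≡.≡-Reasoning

∣b∷p∣ : ∀ {n} b (p : Subset n) → ∣ b ∷ p ∣ ≡ ∣ b ∷ [] ∣ ℕ.+ ∣ p ∣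
∣b∷p∣ inside  p = ≡.refl
∣b∷p∣ outside p = ≡.refl

⌊suc≟suc⌋ : ∀ {r} (x j : Fin r) → ⌊ fsuc x ≟ fsuc j ⌋ ≡ ⌊ x ≟ j ⌋
⌊suc≟suc⌋ x j = ≡.trans (isYes≗does (fsuc x ≟ fsuc j)) (≡.sym (isYes≗does (x ≟ j)))

∑-∣x≟j∣ : ∀ {r} (x : Fin r) → ℕ∑.sum (λ j → ∣ ⌊ x ≟ j ⌋ ∷ [] ∣) ≡ 1
∑-∣x≟j∣ {suc r} fzero    = ≡.cong suc (ℕ∑.sum-replicate-zero r)
∑-∣x≟j∣ {suc r} (fsuc x) =
  ≡.trans (ℕ∑.sum-cong-≗ (λ j → ≡.cong (λ b → ∣ b ∷ [] ∣) (⌊suc≟suc⌋ x j))) (∑-∣x≟j∣ x)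

∑-∣partSet∣ : ∀ {s r} (part : Fin s → Fin r) → ℕ∑.sum (λ j → ∣ partSet part j ∣) ≡ s
∑-∣partSet∣ {zero}  {r} part = ℕ∑.sum-replicate-zero r
∑-∣partSet∣ {suc s} {r} part = begin
  ℕ∑.sum (λ j → ∣ partSet part j ∣)
    ≡⟨ ℕ∑.sum-cong-≗ (λ j → ∣b∷p∣ ⌊ part fzero ≟ j ⌋ (partSet (part ∘ fsuc) j)) ⟩
  ℕ∑.sum (λ j → ∣ ⌊ part fzero ≟ j ⌋ ∷ [] ∣ ℕ.+ ∣ partSet (part ∘ fsuc) j ∣)
    ≡⟨ ℕ∑.∑-distrib-+ (λ j → ∣ ⌊ part fzero ≟ j ⌋ ∷ [] ∣) (λ j → ∣ partSet (part ∘ fsuc) j ∣) ⟩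
  ℕ∑.sum (λ j → ∣ ⌊ part fzero ≟ j ⌋ ∷ [] ∣) ℕ.+ ℕ∑.sum (λ j → ∣ partSet (part ∘ fsuc) j ∣)
    ≡⟨ ≡.cong₂ ℕ._+_ (∑-∣x≟j∣ (part fzero)) (∑-∣partSet∣ (part ∘ fsuc)) ⟩
  suc s ∎
  where open ≡.≡-Reasoning

∈partSet⇒ : ∀ {s r} (part : Fin s → Fin r) {j v} → v ∈ partSet part j → part v ≡ j
∈partSet⇒ part {j} {fzero} v∈ with part fzero ≟ j
... | yes part0≡j = part0≡j
∈partSet⇒ part {j} {fzero} () | no _
∈partSet⇒ part {v = fsuc v} (there v∈) = ∈partSet⇒ (part ∘ fsuc) v∈

∣p∪q∣≡∣p∣+∣q∣ : ∀ {n} (p q : Subset n) → Empty (p ∩ q) → ∣ p ∪ q ∣ ≡ ∣ p ∣ ℕ.+ ∣ q ∣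
∣p∪q∣≡∣p∣+∣q∣ []            []            _     = ≡.refl
∣p∪q∣≡∣p∣+∣q∣ (inside  ∷ p) (inside  ∷ q) empty = ⊥-elim (empty (fzero , here))
∣p∪q∣≡∣p∣+∣q∣ (inside  ∷ p) (outside ∷ q) empty = ≡.cong suc (∣p∪q∣≡∣p∣+∣q∣ p q (drop-∷-Empty empty))
∣p∪q∣≡∣p∣+∣q∣ (outside ∷ p) (inside  ∷ q) empty =
  ≡.trans (≡.cong suc (∣p∪q∣≡∣p∣+∣q∣ p q (drop-∷-Empty empty))) (≡.sym (ℕₚ.+-suc ∣ p ∣ ∣ q ∣))
∣p∪q∣≡∣p∣+∣q∣ (outside ∷ p) (outside ∷ q) empty = ∣p∪q∣≡∣p∣+∣q∣ p q (drop-∷-Empty empty)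

∈⋃-tabulate⁻ : ∀ {n k} (C : Fin k → Subset n) {v} → v ∈ ⋃ (tabulate C) → ∃[ i ] v ∈ C i
∈⋃-tabulate⁻ {k = zero}  C v∈ = ⊥-elim (∉⊥ v∈)
∈⋃-tabulate⁻ {k = suc k} C v∈ with x∈p∪q⁻ (C fzero) (⋃ (tabulate (C ∘ fsuc))) v∈
... | inj₁ v∈C₀ = fzero , v∈C₀
... | inj₂ v∈⋃ with ∈⋃-tabulate⁻ (C ∘ fsuc) v∈⋃
...   | i , v∈Cᵢ = fsuc i , v∈Cᵢ

module OrderedCommRingProperties {c ℓ₁ ℓ₂} (R : OrderedCommRing c ℓ₁ ℓ₂) where
  open OrderedCommRing R
  open IsTotalOrder isTotalOrder public using (total)
    renaming (refl to ≤-refl; reflexive to ≤-reflexive; trans to ≤-trans)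
  open CommutativeMonoidSum +-commutativeMonoid public using (sum)
  open CommutativeMonoidSolver +-commutativeMonoid public using (_⊜_; _⊕_) renaming (solve to +-solve)

  poset : Poset c ℓ₁ ℓ₂
  poset = record { isPartialOrder = IsTotalOrder.isPartialOrder isTotalOrder }

  module ≤-Reasoning = PosetReasoning poset

  +-monoʳ-≤ : ∀ x {y z} → y ≤ z → (x + y) ≤ (x + z)
  +-monoʳ-≤ x {y} {z} y≤z =
    ≤-trans (≤-reflexive (+-comm x y)) (≤-trans (+-monoˡ-≤ x y≤z) (≤-reflexive (+-comm z x)))

  +-mono-≤ : ∀ {x y z w} → x ≤ y → z ≤ w → (x + z) ≤ (y + w)
  +-mono-≤ {y = y} {z} x≤y z≤w = ≤-trans (+-monoˡ-≤ z x≤y) (+-monoʳ-≤ y z≤w)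

  +-cancelʳ-≤ : ∀ {x y} z → (x + z) ≤ (y + z) → x ≤ y
  +-cancelʳ-≤ {x} {y} z x+z≤y+z = begin
    x                ≈⟨ cancel x ⟨
    x + z + (- z)    ≤⟨ +-monoˡ-≤ (- z) x+z≤y+z ⟩
    y + z + (- z)    ≈⟨ cancel y ⟩
    y                ∎
    where
    open ≤-Reasoning
    cancel : ∀ u → ((u + z) + (- z)) ≈ u
    cancel u = trans (+-assoc u z (- z)) (trans (+-congˡ (-‿inverseʳ z)) (+-identityʳ u))

  -- x − z ≤ w − y and w − y ≤ q − p give x − z ≤ q − p; stated without subtraction.
  +-≤-transfer : ∀ {x y z w p q} → (x + y) ≤ (z + w) → (w + p) ≤ (y + q) → (x + p) ≤ (z + q)
  +-≤-transfer {x} {y} {z} {w} {p} {q} h₁ h₂ = +-cancelʳ-≤ (y + w) (begin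
    (x + p) + (y + w)   ≈⟨ +-solve 4 (λ x y w p → (x ⊕ p) ⊕ (y ⊕ w) ⊜ (x ⊕ y) ⊕ (w ⊕ p)) refl x y w p ⟩
    (x + y) + (w + p)   ≤⟨ +-mono-≤ h₁ h₂ ⟩
    (z + w) + (y + q)   ≈⟨ +-solve 4 (λ z w y q → (z ⊕ w) ⊕ (y ⊕ q) ⊜ (z ⊕ q) ⊕ (y ⊕ w)) refl z w y q ⟩
    (z + q) + (y + w)   ∎)
    where open ≤-Reasoning

  x≤x+y : ∀ {x y} → 0# ≤ y → x ≤ (x + y)
  x≤x+y {x} 0≤y = ≤-trans (≤-reflexive (sym (+-identityʳ x))) (+-monoʳ-≤ x 0≤y)

  -- If 1 ≤ 0 then 0 ≤ −1, so 0 ≤ (−1)(−1) = 1.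
  0≤1 : 0# ≤ 1#
  0≤1 with total 0# 1#
  ... | inj₁ 0≤1 = 0≤1
  ... | inj₂ 1≤0 = ≤-trans (*-nonneg 0≤-1 0≤-1) (≤-reflexive -1*-1≈1)
    where
    open RingProperties ring using (-‿distribˡ-*; -‿involutive)
    0≤-1 : 0# ≤ (- 1#)
    0≤-1 = ≤-trans (≤-reflexive (sym (-‿inverseʳ 1#)))
             (≤-trans (+-monoˡ-≤ (- 1#) 1≤0) (≤-reflexive (+-identityˡ (- 1#))))
    -1*-1≈1 : ((- 1#) * (- 1#)) ≈ 1#
    -1*-1≈1 = trans (sym (-‿distribˡ-* 1# (- 1#)))
                (trans (-‿cong (*-identityˡ (- 1#))) (-‿involutive 1#))

  0≤fromℕ : ∀ n → 0# ≤ fromℕ n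
  0≤fromℕ zero    = ≤-refl
  0≤fromℕ (suc n) = ≤-trans (≤-reflexive (sym (+-identityʳ 0#))) (+-mono-≤ 0≤1 (0≤fromℕ n))

  fromℕ-+ : ∀ m n → fromℕ (m ℕ.+ n) ≈ (fromℕ m + fromℕ n)
  fromℕ-+ zero    n = sym (+-identityˡ (fromℕ n))
  fromℕ-+ (suc m) n = trans (+-congˡ (fromℕ-+ m n)) (sym (+-assoc 1# (fromℕ m) (fromℕ n)))

  fromℕ-+-* : ∀ m n x → (fromℕ (m ℕ.+ n) * x) ≈ (fromℕ m * x + fromℕ n * x)
  fromℕ-+-* m n x = trans (*-congʳ (fromℕ-+ m n)) (distribʳ x (fromℕ m) (fromℕ n))

  fromℕ-sum : ∀ {n} (t : Fin n → ℕ) → fromℕ (ℕ∑.sum t) ≈ sum (fromℕ ∘ t)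
  fromℕ-sum {zero}  t = refl
  fromℕ-sum {suc n} t = trans (fromℕ-+ (t fzero) _) (+-congˡ (fromℕ-sum (t ∘ fsuc)))

  sum-mono-≤ : ∀ {n} {t u : Fin n → Carrier} → (∀ i → t i ≤ u i) → sum t ≤ sum u
  sum-mono-≤ {zero}  t≤u = ≤-refl
  sum-mono-≤ {suc n} t≤u = +-mono-≤ (t≤u fzero) (sum-mono-≤ (t≤u ∘ fsuc))

  fromℕ-*-monoˡ-≤ : ∀ {m n x} → m ≤ℕ n → 0# ≤ x → (fromℕ m * x) ≤ (fromℕ n * x)
  fromℕ-*-monoˡ-≤ {m} {n} {x} m≤n 0≤x = begin
    fromℕ m * x                             ≤⟨ x≤x+y (*-nonneg (0≤fromℕ (n ℕ.∸ m)) 0≤x) ⟩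
    fromℕ m * x + fromℕ (n ℕ.∸ m) * x       ≈⟨ fromℕ-+-* m (n ℕ.∸ m) x ⟨
    fromℕ (m ℕ.+ (n ℕ.∸ m)) * x             ≡⟨ ≡.cong (λ k → fromℕ k * x) (ℕₚ.m+[n∸m]≡n m≤n) ⟩
    fromℕ n * x                             ∎
    where open ≤-Reasoning

module Concavity {c ℓ₁ ℓ₂} (R : OrderedCommRing c ℓ₁ ℓ₂) {h : ℕ → OrderedCommRing.Carrier R}
  (concave : Concave R h) where
  open OrderedCommRing R
  open OrderedCommRingProperties R

  h-cong : ∀ {m n} → m ≡ n → h m ≈ h n
  h-cong m≡n = reflexive (≡.cong h m≡n)

  concave-exchange₁ : ∀ i d → (h (suc (d ℕ.+ i)) + h i) ≤ (h (suc i) + h (d ℕ.+ i))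
  concave-exchange₁ i zero    = ≤-refl
  concave-exchange₁ i (suc d) =
    ≤-trans (+-≤-transfer (concave (d ℕ.+ i)) (≤-trans (concave-exchange₁ i d) (≤-reflexive (+-comm _ _))))
            (≤-reflexive (+-comm _ _))

  concave-exchange-+ : ∀ u d k → (h (k ℕ.+ (d ℕ.+ u)) + h u) ≤ (h (k ℕ.+ u) + h (d ℕ.+ u))
  concave-exchange-+ u d zero    = ≤-reflexive (+-comm _ _)
  concave-exchange-+ u d (suc k) = +-≤-transfer step (concave-exchange-+ u d k)
    where
    shift : d ℕ.+ (k ℕ.+ u) ≡ k ℕ.+ (d ℕ.+ u)
    shift = x∙yz≈y∙xz d k u
    step : (h (suc (k ℕ.+ (d ℕ.+ u))) + h (k ℕ.+ u)) ≤ (h (suc (k ℕ.+ u)) + h (k ℕ.+ (d ℕ.+ u)))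
    step = ≤-trans (≤-reflexive (+-congʳ (h-cong (≡.cong suc (≡.sym shift)))))
             (≤-trans (concave-exchange₁ (k ℕ.+ u) d) (≤-reflexive (+-congˡ (h-cong shift))))

  concave-exchange : ∀ {u x y v} → u ≤ℕ x → u ≤ℕ y → u ℕ.+ v ≡ x ℕ.+ y →
                     (h u + h v) ≤ (h x + h y)
  concave-exchange {u} {x} {y} {v} u≤x u≤y u+v≡x+y = begin
    h u + h v                           ≈⟨ +-comm _ _ ⟩
    h v + h u                           ≈⟨ +-congʳ (h-cong v≡k+[d+u]) ⟩
    h (k ℕ.+ (d ℕ.+ u)) + h u           ≤⟨ concave-exchange-+ u d k ⟩
    h (k ℕ.+ u) + h (d ℕ.+ u)           ≈⟨ +-cong (h-cong x≡k+u) (h-cong y≡d+u) ⟨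
    h x + h y                           ∎
    where
    open ≤-Reasoning
    k d : ℕ
    k = x ℕ.∸ u
    d = y ℕ.∸ u
    x≡k+u : x ≡ k ℕ.+ u
    x≡k+u = ≡.sym (ℕₚ.m∸n+n≡m u≤x)
    y≡d+u : y ≡ d ℕ.+ u
    y≡d+u = ≡.sym (ℕₚ.m∸n+n≡m u≤y)
    v≡k+[d+u] : v ≡ k ℕ.+ (d ℕ.+ u)
    v≡k+[d+u] = ≡.trans (u+v≡x+y⇒v≡x∸u+y u≤x u+v≡x+y) (≡.cong (k ℕ.+_) y≡d+u)

  subadditive : 0# ≤ h 0 → ∀ x y → h (x ℕ.+ y) ≤ (h x + h y)
  subadditive 0≤h0 x y = ≤-trans (≤-trans (x≤x+y 0≤h0) (≤-reflexive (+-comm _ _)))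
                           (concave-exchange z≤n z≤n ≡.refl)

module ConcaveSums {c ℓ₁ ℓ₂} (R : OrderedCommRing c ℓ₁ ℓ₂) where
  open OrderedCommRing R
  open OrderedCommRingProperties R

  module _ (a : ℕ) {h : ℕ → Carrier} (concave : Concave R h) (h0≈0 : h 0 ≈ 0#) (nonneg : ∀ i → 0# ≤ h i) where
    open Concavity R concave

    record Decomposition (n : ℕ) (bound : Carrier) : Set ℓ₂ where
      field
        quotient remainder : ℕ
        remainder≤a : remainder ≤ℕ a
        n≡ : quotient ℕ.* a ℕ.+ remainder ≡ n
        value≤bound : (fromℕ quotient * h a + h remainder) ≤ bound

    open Decomposition

    remainder-only : ∀ {m} → m ≤ℕ a → Decomposition m (h m)
    remainder-only {m} m≤a = record
      { quotient = 0 ; remainder = m ; remainder≤a = m≤a ; n≡ = ≡.refl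
      ; value≤bound = ≤-reflexive (trans (+-congʳ (zeroˡ (h a))) (+-identityˡ (h m))) }

    weaken : ∀ {n Y Y′} → Decomposition n Y → Y ≤ Y′ → Decomposition n Y′
    weaken D Y≤Y′ = record
      { quotient = quotient D ; remainder = remainder D ; remainder≤a = remainder≤a D ; n≡ = n≡ D
      ; value≤bound = ≤-trans (value≤bound D) Y≤Y′ }

    empty : Decomposition 0 0#
    empty = weaken (remainder-only z≤n) (≤-reflexive h0≈0)

    carry : ∀ {m p} → m ≤ℕ a → p ≤ℕ a → Decomposition (m ℕ.+ p) (h m + h p)
    carry {m} {p} m≤a p≤a with m ℕ.+ p ℕ.≤? a
    ... | yes m+p≤a = weaken (remainder-only m+p≤a) (subadditive (nonneg 0) m p)
    ... | no m+p≰a = record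
      { quotient = 1 ; remainder = u ; remainder≤a = ℕₚ.≤-trans u≤m m≤a
      ; n≡ = ≡.trans (≡.cong (ℕ._+ u) (ℕₚ.*-identityˡ a)) (≡.trans (ℕₚ.+-comm a u) u+a≡m+p)
      ; value≤bound = begin
          fromℕ 1 * h a + h u    ≈⟨ +-congʳ (trans (*-congʳ (+-identityʳ 1#)) (*-identityˡ (h a))) ⟩
          h a + h u              ≈⟨ +-comm (h a) (h u) ⟩
          h u + h a              ≤⟨ concave-exchange u≤m u≤p u+a≡m+p ⟩
          h m + h p              ∎ }
      where
      open ≤-Reasoning
      u : ℕ
      u = m ℕ.+ p ℕ.∸ a
      u+a≡m+p : u ℕ.+ a ≡ m ℕ.+ p
      u+a≡m+p = ℕₚ.m∸n+n≡m (ℕₚ.<⇒≤ (ℕₚ.≰⇒> m+p≰a))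
      u≤m : u ≤ℕ m
      u≤m = ℕₚ.≤-trans (ℕₚ.∸-monoʳ-≤ (m ℕ.+ p) p≤a) (ℕₚ.≤-reflexive (ℕₚ.m+n∸n≡m m p))
      u≤p : u ≤ℕ p
      u≤p = ℕₚ.≤-trans (ℕₚ.∸-monoʳ-≤ (m ℕ.+ p) m≤a) (ℕₚ.≤-reflexive (ℕₚ.m+n∸m≡n m p))

    merge : ∀ {n₁ n₂ Y₁ Y₂} → Decomposition n₁ Y₁ → Decomposition n₂ Y₂ →
            Decomposition (n₁ ℕ.+ n₂) (Y₁ + Y₂)
    merge {Y₁ = Y₁} {Y₂} D₁ D₂ = record
      { quotient = k₁ ℕ.+ k₂ ℕ.+ k₃ ; remainder = remainder D₃ ; remainder≤a = remainder≤a D₃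
      ; n≡ = ≡.trans (quotient-remainder-merge k₁ k₂ a (n≡ D₃)) (≡.cong₂ ℕ._+_ (n≡ D₁) (n≡ D₂))
      ; value≤bound = value≤bound′ }
      where
      k₁ k₂ m₁ m₂ : ℕ
      k₁ = quotient D₁
      k₂ = quotient D₂
      m₁ = remainder D₁
      m₂ = remainder D₂
      D₃ : Decomposition (m₁ ℕ.+ m₂) (h m₁ + h m₂)
      D₃ = carry (remainder≤a D₁) (remainder≤a D₂)
      k₃ m₃ : ℕ
      k₃ = quotient D₃
      m₃ = remainder D₃
      K₁ K₂ K₃ : Carrier
      K₁ = fromℕ k₁ * h a
      K₂ = fromℕ k₂ * h a
      K₃ = fromℕ k₃ * h a
      value≤bound′ : (fromℕ (k₁ ℕ.+ k₂ ℕ.+ k₃) * h a + h m₃) ≤ (Y₁ + Y₂)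
      value≤bound′ = begin
        fromℕ (k₁ ℕ.+ k₂ ℕ.+ k₃) * h a + h m₃
          ≈⟨ +-congʳ (trans (fromℕ-+-* (k₁ ℕ.+ k₂) k₃ (h a)) (+-congʳ (fromℕ-+-* k₁ k₂ (h a)))) ⟩
        (K₁ + K₂ + K₃) + h m₃
          ≈⟨ +-assoc (K₁ + K₂) K₃ (h m₃) ⟩
        (K₁ + K₂) + (K₃ + h m₃)
          ≤⟨ +-monoʳ-≤ (K₁ + K₂) (value≤bound D₃) ⟩
        (K₁ + K₂) + (h m₁ + h m₂)
          ≈⟨ +-solve 4 (λ K₁ K₂ x y → (K₁ ⊕ K₂) ⊕ (x ⊕ y) ⊜ (K₁ ⊕ x) ⊕ (K₂ ⊕ y)) refl K₁ K₂ (h m₁) (h m₂) ⟩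
        (K₁ + h m₁) + (K₂ + h m₂)
          ≤⟨ +-mono-≤ (value≤bound D₁) (value≤bound D₂) ⟩
        Y₁ + Y₂
          ∎
        where open ≤-Reasoning

    decompose : ∀ {n} (p : Fin n → ℕ) → (∀ i → p i ≤ℕ a) → Decomposition (ℕ∑.sum p) (sum (h ∘ p))
    decompose {zero}  p p≤a = empty
    decompose {suc n} p p≤a = merge (remainder-only (p≤a fzero)) (decompose (p ∘ fsuc) (p≤a ∘ fsuc))

    floorDiv-bound : ∀ {n Y} → Decomposition n Y → (fromℕ (floorDiv n a) * h a) ≤ Y
    floorDiv-bound {Y = Y} record
      { quotient = k ; remainder = m ; remainder≤a = m≤a ; n≡ = ≡.refl ; value≤bound = bound }
      with floorDiv-*+ k m≤a
    ... | inj₁ q≤k = begin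
      fromℕ (floorDiv (k ℕ.* a ℕ.+ m) a) * h a   ≤⟨ fromℕ-*-monoˡ-≤ q≤k (nonneg a) ⟩
      fromℕ k * h a                              ≤⟨ x≤x+y (nonneg m) ⟩
      fromℕ k * h a + h m                        ≤⟨ bound ⟩
      Y                                          ∎
      where open ≤-Reasoning
    ... | inj₂ (≡.refl , q≡1+k) = begin
      fromℕ (floorDiv (k ℕ.* a ℕ.+ a) a) * h a   ≡⟨ ≡.cong (λ q → fromℕ q * h a) q≡1+k ⟩
      (1# + fromℕ k) * h a                       ≈⟨ distribʳ (h a) 1# (fromℕ k) ⟩
      1# * h a + fromℕ k * h a                   ≈⟨ trans (+-congʳ (*-identityˡ (h a))) (+-comm _ _) ⟩
      fromℕ k * h a + h a                        ≤⟨ bound ⟩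
      Y                                          ∎
      where open ≤-Reasoning

    ∑-floorDiv-bound : ∀ {n} (p : Fin n → ℕ) → (∀ i → p i ≤ℕ a) →
                       (fromℕ (floorDiv (ℕ∑.sum p) a) * h a) ≤ sum (h ∘ p)
    ∑-floorDiv-bound p p≤a = floorDiv-bound (decompose p p≤a)

module _ {s r} (part : Fin s → Fin r) where

  Separated : Subset s → Subset s → Set
  Separated A B = ∀ {u v} → u ∈ A → v ∈ B → part u ≢ part v

  PairwiseSeparated : ∀ {k} → (Fin k → Subset s) → Set
  PairwiseSeparated C = ∀ {i j} → i ≢ j → Separated (C i) (C j)

  separated⇒disjoint : ∀ {A B} → Separated A B → Empty (A ∩ B)
  separated⇒disjoint {A} {B} sep (v , v∈A∩B) with x∈p∩q⁻ A B v∈A∩B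
  ... | v∈A , v∈B = sep v∈A v∈B ≡.refl

  pairwiseSeparated-tail : ∀ {k} {C : Fin (suc k) → Subset s} →
                           PairwiseSeparated C → PairwiseSeparated (C ∘ fsuc)
  pairwiseSeparated-tail sep i≢j = sep (i≢j ∘ Finₚ.suc-injective)

  ⊆partSet⇒pairwiseSeparated : ∀ {C : Fin r → Subset s} → (∀ j → C j ⊆ partSet part j) →
                               PairwiseSeparated C
  ⊆partSet⇒pairwiseSeparated C⊆part {i} {j} i≢j u∈Cᵢ v∈Cⱼ part-u≡part-v =
    i≢j (≡.trans (≡.sym (∈partSet⇒ part (C⊆part i u∈Cᵢ)))
                 (≡.trans part-u≡part-v (∈partSet⇒ part (C⊆part j v∈Cⱼ))))

  separated-⋃-tail : ∀ {k} (C : Fin (suc k) → Subset s) → PairwiseSeparated C →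
                     Separated (C fzero) (⋃ (tabulate (C ∘ fsuc)))
  separated-⋃-tail C sep u∈C₀ v∈⋃ with ∈⋃-tabulate⁻ (C ∘ fsuc) v∈⋃
  ... | i , v∈Cᵢ = sep (λ ()) u∈C₀ v∈Cᵢ

  ∣⋃∣≡∑∣∣ : ∀ {k} (C : Fin k → Subset s) → PairwiseSeparated C →
            ∣ ⋃ (tabulate C) ∣ ≡ ℕ∑.sum (∣_∣ ∘ C)
  ∣⋃∣≡∑∣∣ {zero}  C sep = ∣⊥∣≡0 s
  ∣⋃∣≡∑∣∣ {suc k} C sep =
    ≡.trans (∣p∪q∣≡∣p∣+∣q∣ (C fzero) _ (separated⇒disjoint (separated-⋃-tail C sep)))
            (≡.cong (∣ C fzero ∣ ℕ.+_) (∣⋃∣≡∑∣∣ (C ∘ fsuc) (pairwiseSeparated-tail sep)))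

IsCograph⁰ : ∀ {s} → Graph s → Subset s → Set
IsCograph⁰ G C = Empty C ⊎ IsCograph G C

module _ {s r} (G : Graph s) (part : Fin s → Fin r)
  (pure : (∀ u v → part u ≢ part v → Graph.Adj G u v) ⊎
          (∀ u v → part u ≢ part v → ¬ Graph.Adj G u v)) where

  separated⇒pure : ∀ {A B} → Separated part A B → Complete G A B ⊎ Anticomplete G A B
  separated⇒pure sep = Sum.map (λ adj u v u∈A v∈B → adj u v (sep u∈A v∈B))
                               (λ nonadj u v u∈A v∈B → nonadj u v (sep u∈A v∈B)) pure

  ∪-cograph⁰ : ∀ {A B} → IsCograph⁰ G A → IsCograph⁰ G B → Separated part A B → IsCograph⁰ G (A ∪ B)
  ∪-cograph⁰ {A} {B} (inj₁ A-empty) B-cograph _ = ≡.subst (IsCograph⁰ G) B≡A∪B B-cograph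
    where
    B≡A∪B : B ≡ A ∪ B
    B≡A∪B = ≡.sym (≡.trans (≡.cong (_∪ B) (Empty-unique A-empty)) (∪-identityˡ B))
  ∪-cograph⁰ {A} {B} (inj₂ A-cograph) (inj₁ B-empty) _ = ≡.subst (IsCograph⁰ G) A≡A∪B (inj₂ A-cograph)
    where
    A≡A∪B : A ≡ A ∪ B
    A≡A∪B = ≡.sym (≡.trans (≡.cong (A ∪_) (Empty-unique B-empty)) (∪-identityʳ A))
  ∪-cograph⁰ (inj₂ A-cograph) (inj₂ B-cograph) sep =
    inj₂ (union A-cograph B-cograph (separated⇒disjoint part sep) (separated⇒pure sep))

  ⋃-cograph⁰ : ∀ {k} (C : Fin k → Subset s) → PairwiseSeparated part C →
               (∀ i → IsCograph⁰ G (C i)) → IsCograph⁰ G (⋃ (tabulate C))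
  ⋃-cograph⁰ {zero}  C sep cograph = inj₁ λ { (_ , v∈⊥) → ∉⊥ v∈⊥ }
  ⋃-cograph⁰ {suc k} C sep cograph =
    ∪-cograph⁰ (cograph fzero) (⋃-cograph⁰ (C ∘ fsuc) (pairwiseSeparated-tail part sep) (cograph ∘ fsuc))
               (separated-⋃-tail part C sep)

module ZeroAtOrigin {c ℓ₁ ℓ₂} (R : OrderedCommRing c ℓ₁ ℓ₂) (f : ℕ → OrderedCommRing.Carrier R) where
  open OrderedCommRing R
  open OrderedCommRingProperties R

  -- The bound available for a part of size n: the hypothesis says nothing about the empty set.
  f⁰ : ℕ → Carrier
  f⁰ zero    = 0#
  f⁰ (suc n) = f (suc n)

  f⁰-concave : 0# ≤ f 0 → Concave R f → Concave R f⁰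
  f⁰-concave 0≤f0 concave zero    = ≤-trans (+-monoʳ-≤ (f 2) 0≤f0) (concave 0)
  f⁰-concave 0≤f0 concave (suc i) = concave (suc i)

  f⁰-nonneg : (∀ i → 0# ≤ f i) → ∀ i → 0# ≤ f⁰ i
  f⁰-nonneg nonneg zero    = ≤-refl
  f⁰-nonneg nonneg (suc i) = nonneg (suc i)

  floorDiv-*-f⁰ : ∀ n a → (fromℕ (floorDiv n a) * f a) ≈ (fromℕ (floorDiv n a) * f⁰ a)
  floorDiv-*-f⁰ n zero    = trans (zeroˡ (f 0)) (sym (zeroˡ 0#))
  floorDiv-*-f⁰ n (suc a) = refl

  record LargeCograph⁰ {s} (G : Graph s) (T : Subset s) : Set ℓ₂ where
    field
      vertices   : Subset s
      ⊆T         : vertices ⊆ T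
      isCograph⁰ : IsCograph⁰ G vertices
      large      : f⁰ ∣ T ∣ ≤ fromℕ ∣ vertices ∣

  largeCograph⁰ : ∀ {s} (G : Graph s) →
    (∀ (T : Subset s) → 1 ≤ℕ ∣ T ∣ → Σ (Subset s) (λ C → C ⊆ T × IsCograph G C × f ∣ T ∣ ≤ fromℕ ∣ C ∣)) →
    ∀ (T : Subset s) → LargeCograph⁰ G T
  largeCograph⁰ {s} G cographs T with ∣ T ∣ in ∣T∣≡n
  ... | zero = record
    { vertices = ⊥ ; ⊆T = λ v∈⊥ → ⊥-elim (∉⊥ v∈⊥) ; isCograph⁰ = inj₁ (λ { (_ , v∈⊥) → ∉⊥ v∈⊥ })
    ; large = ≤-trans (≤-reflexive (reflexive (≡.cong f⁰ ∣T∣≡n))) (0≤fromℕ ∣ ⊥ {n = s} ∣) }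
  ... | suc n with cographs T (≡.subst (1 ≤ℕ_) (≡.sym ∣T∣≡n) (s≤s z≤n))
  ...   | C , C⊆T , C-cograph , C-large = record
    { vertices = C ; ⊆T = C⊆T ; isCograph⁰ = inj₂ C-cograph
    ; large = ≤-trans (≤-reflexive (reflexive (≡.trans (≡.cong f⁰ ∣T∣≡n) (≡.cong f (≡.sym ∣T∣≡n))))) C-large }

lemma3p3 : ∀ {c ℓ₁ ℓ₂ : Level} (R : OrderedCommRing c ℓ₁ ℓ₂) →
    let open OrderedCommRing R in
    (f : ℕ → Carrier) → Positive R f → Concave R f → Increasing R f →
    (a s r : ℕ) (G : Graph s) (part : Fin s → Fin r) →
    (∀ j → ∣ partSet part j ∣ ≤ℕ a) →
    ((∀ u v → part u ≢ part v → Graph.Adj G u v) ⊎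
     (∀ u v → part u ≢ part v → ¬ Graph.Adj G u v)) →
    (∀ (T : Subset s) → 1 ≤ℕ ∣ T ∣ → Σ (Subset s) (λ C →
       C ⊆ T × IsCograph G C × f ∣ T ∣ ≤ fromℕ ∣ C ∣)) →
    Σ (Subset s) (λ C → (Empty C ⊎ IsCograph G C) × (fromℕ (floorDiv s a) * f a) ≤ fromℕ ∣ C ∣)
lemma3p3 R f positive concave _ a s r G part parts≤a pure cographs = D , D-cograph , D-large
  where
  open OrderedCommRing R
  open OrderedCommRingProperties R
  open ZeroAtOrigin R f
  nonneg : ∀ i → 0# ≤ f i
  nonneg i = proj₁ (positive i)
  open ConcaveSums R using (∑-floorDiv-bound)

  P : Fin r → Subset s
  P = partSet part
  module C (j : Fin r) = LargeCograph⁰ (largeCograph⁰ G cographs (P j))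
  C : Fin r → Subset s
  C = C.vertices
  separated : PairwiseSeparated part C
  separated = ⊆partSet⇒pairwiseSeparated part C.⊆T

  D : Subset s
  D = ⋃ (tabulate C)
  D-cograph : IsCograph⁰ G D
  D-cograph = ⋃-cograph⁰ G part pure C separated C.isCograph⁰

  D-large : (fromℕ (floorDiv s a) * f a) ≤ fromℕ ∣ D ∣
  D-large = begin
    fromℕ (floorDiv s a) * f a
      ≈⟨ floorDiv-*-f⁰ s a ⟩
    fromℕ (floorDiv s a) * f⁰ a
      ≡⟨ ≡.cong (λ n → fromℕ (floorDiv n a) * f⁰ a) (∑-∣partSet∣ part) ⟨
    fromℕ (floorDiv (ℕ∑.sum (∣_∣ ∘ P)) a) * f⁰ a
      ≤⟨ ∑-floorDiv-bound a (f⁰-concave (nonneg 0) concave) refl (f⁰-nonneg nonneg) (∣_∣ ∘ P) parts≤a ⟩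
    sum (f⁰ ∘ ∣_∣ ∘ P)
      ≤⟨ sum-mono-≤ C.large ⟩
    sum (fromℕ ∘ ∣_∣ ∘ C)
      ≈⟨ fromℕ-sum (∣_∣ ∘ C) ⟨
    fromℕ (ℕ∑.sum (∣_∣ ∘ C))
      ≡⟨ ≡.cong fromℕ (∣⋃∣≡∑∣∣ part C separated) ⟨
    fromℕ ∣ D ∣
      ∎
    where open ≤-Reasoning
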